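{- For fractional matchings in the adversarial edge arrival model, no online algorithm achieves a guarantee larger than $0.58884$ on bipartite graphs of maximum degree four. That is, if an online fractional matching algorithm achieves guarantee $\gamma$ on all bipartite graphs of maximum degree at most four, then $\gamma \leq 0.58884$.
   Context: Online fractional matching with adversarial edge arrivals: the edges of a graph are revealed one at a time (possibly several in a batch, i.e. in some order) chosen by an adversary. When an edge $e$ arrives, the algorithm must immediately and irrevocably assign it a value $y_e \geq 0$, such that at every timepoint, for every vertex $w$, the sum of the values of the arrived edges incident to $w$ is at most $1$. An algorithm achieves guarantee $\gamma$ on a class of graphs if for every graph in the class and every arrival order, at every timepoint the total value $\sum_e y_e$ of the arrived edges is at least $\gamma$ times the maximum cardinality of a matching in the graph formed by the already arrived edges. -}

module Defs where

open import Level using (Level; _⊔_; suc)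
open import Algebra.Bundles using (CommutativeRing)
open import Relation.Binary.Structures using (IsTotalOrder)
open import Data.Nat as ℕ using (ℕ; zero)
open import Data.Bool using (Bool)
open import Data.Product using (_×_; _,_; ∃; Σ)
open import Data.Sum using (_⊎_)
open import Data.List using (List; []; _∷_; _++_; [_]; length; filter; take)
open import Data.List.Relation.Unary.All using (All)
open import Data.List.Relation.Unary.AllPairs using (AllPairs)
open import Data.List.Membership.Propositional using (_∈_)
open import Relation.Binary.PropositionalEquality using (_≡_; _≢_)
open import Relation.Nullary using (¬_; Dec; yes; no)
open import Data.Sum.Relation.Unary.All using ()
open import Relation.Nullary.Decidable using (_⊎-dec_)

-- Ordered fields (the stdlib has no reals; we quantify over every
-- ordered field, which includes ℝ).

record OrderedField (c ℓ₁ ℓ₂ : Level) : Set (Level.suc (c ⊔ ℓ₁ ⊔ ℓ₂)) where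
  field
    commutativeRing : CommutativeRing c ℓ₁
  open CommutativeRing commutativeRing public
  field
    _≤_           : Carrier → Carrier → Set ℓ₂
    isTotalOrder  : IsTotalOrder _≈_ _≤_
    +-mono-≤      : ∀ {x y} z → x ≤ y → (x + z) ≤ (y + z)
    *-nonneg      : ∀ {x y} → 0# ≤ x → 0# ≤ y → 0# ≤ (x * y)
    nontrivial    : ¬ (1# ≈ 0#)
    inverse       : ∀ x → ¬ (x ≈ 0#) → Σ Carrier (λ y → (x * y) ≈ 1#)

  fromℕ : ℕ → Carrier
  fromℕ zero      = 0#
  fromℕ (ℕ.suc n) = 1# + fromℕ n

-- Graphs on vertex set ℕ, given as the list of their edges in arrival
-- order.  An edge is a pair (u , v), read as the unordered pair {u,v}.

Vertex : Set
Vertex = ℕ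

Edge : Set
Edge = Vertex × Vertex

Incident : Vertex → Edge → Set
Incident w (u , v) = (w ≡ u) ⊎ (w ≡ v)

incident? : ∀ w e → Dec (Incident w e)
incident? w (u , v) = (w ℕ.≟ u) ⊎-dec (w ℕ.≟ v)

SameEdge : Edge → Edge → Set
SameEdge (u , v) (u' , v') = ((u ≡ u') × (v ≡ v')) ⊎ ((u ≡ v') × (v ≡ u'))

VertexDisjoint : Edge → Edge → Set
VertexDisjoint (u , v) (u' , v') = (u ≢ u') × (u ≢ v') × (v ≢ u') × (v ≢ v')

SimpleGraph : List Edge → Set
SimpleGraph es = All (λ e → Data.Product.proj₁ e ≢ Data.Product.proj₂ e) es
               × AllPairs (λ e f → ¬ SameEdge e f) es

Bipartite : List Edge → Set
Bipartite es = ∃ λ (col : Vertex → Bool) →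
  All (λ e → col (Data.Product.proj₁ e) ≢ col (Data.Product.proj₂ e)) es

degree : Vertex → List Edge → ℕ
degree w es = length (filter (incident? w) es)

MaxDegreeAtMost : ℕ → List Edge → Set
MaxDegreeAtMost k es = ∀ w → degree w es ℕ.≤ k

BipartiteMaxDeg4 : List Edge → Set
BipartiteMaxDeg4 es = SimpleGraph es × Bipartite es × MaxDegreeAtMost 4 es

IsMatching : List Edge → List Edge → Set
IsMatching G M = All (_∈ G) M × AllPairs VertexDisjoint M

IsMaximumMatching : List Edge → List Edge → Set
IsMaximumMatching G M =
  IsMatching G M × (∀ M' → IsMatching G M' → length M' ℕ.≤ length M)

module _ {c ℓ₁ ℓ₂} (F : OrderedField c ℓ₁ ℓ₂) where
  open OrderedField F

  -- A deterministic online algorithm: given the list of previously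
  -- arrived edges (in arrival order) and the newly arriving edge, it
  -- returns the value assigned to the new edge.
  OnlineAlgorithm : Set c
  OnlineAlgorithm = List Edge → Edge → Carrier

  runFrom : OnlineAlgorithm → List Edge → List Edge → List (Edge × Carrier)
  runFrom A hist []       = []
  runFrom A hist (e ∷ es) = (e , A hist e) ∷ runFrom A (hist ++ [ e ]) es

  run : OnlineAlgorithm → List Edge → List (Edge × Carrier)
  run A es = runFrom A [] es

  total : List (Edge × Carrier) → Carrier
  total []             = 0#
  total ((e , y) ∷ ys) = y + total ys

  load : Vertex → List (Edge × Carrier) → Carrier
  load w []             = 0#
  load w ((e , y) ∷ ys) with incident? w e
  ... | yes _ = y + load w ys
  ... | no  _ = load w ys

  GoodAt : OnlineAlgorithm → Carrier → List Edge → Set (c ⊔ ℓ₂)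
  GoodAt A γ arrived =
    let ys = run A arrived in
      All (λ p → 0# ≤ Data.Product.proj₂ p) ys
    × (∀ w → load w ys ≤ 1#)
    × (∀ M → IsMaximumMatching arrived M → (γ * fromℕ (length M)) ≤ total ys)

  AchievesGuarantee : (List Edge → Set) → OnlineAlgorithm → Carrier → Set (c ⊔ ℓ₂)
  AchievesGuarantee Class A γ =
    ∀ es → Class es → ∀ t → GoodAt A γ (take t es)

-- The adversary presents a 4-cycle and then continues in one of three ways.
-- A deterministic algorithm assigns the same values to the arrivals of a common
-- prefix, so constraints from different continuations can be added up: eight
-- guarantee constraints (maximum matchings of total size 24) against fourteen
-- vertex-capacity constraints (loads at most 1).  Every arrival is counted at
-- least as often among the capacity constraints as among the guarantee ones, so
-- with non-negative values 24 γ ≤ 14, i.e. γ ≤ 7/12 < 0.58884.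

module Submission where

open import Defs
open import Data.Nat as ℕ using (ℕ; zero; suc; z≤n; _<_; _<?_; _%_)
import Data.Nat.Properties as ℕₚ
open import Data.Nat.ListAction using () renaming (sum to sumℕ)
open import Data.Bool as Bool using (Bool)
open import Data.Fin using (Fin; zero; suc; toℕ; fromℕ<; #_)
open import Data.Fin.Properties using (toℕ-fromℕ<) renaming (all? to allFin?)
open import Data.Product using (_×_; _,_; proj₁; proj₂; ∃)
open import Data.Product.Properties using () renaming (≡-dec to ×-≡-dec)
open import Data.Sum using (inj₁; inj₂)
open import Data.Maybe using (Maybe; just; nothing; from-just; _>>=_)
open import Data.List
  using (List; []; _∷_; _++_; [_]; length; filter; map; foldr; take; upTo; concatMap)
open import Data.List.Properties
  using (filter-reject; filter-accept; filter-all; filter-none; map-++; length-upTo)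
  renaming (≡-dec to List-≡-dec)
open import Data.List.Relation.Unary.All as All using (All; []; _∷_; all?)
import Data.List.Relation.Unary.All.Properties as All
open import Data.List.Relation.Unary.Any using (Any; here; there; any?)
open import Data.List.Relation.Unary.AllPairs using (AllPairs; []; _∷_; allPairs?)
import Data.List.Relation.Unary.AllPairs.Properties as AllPairs
open import Data.List.Membership.Propositional.Properties using (∈-∃++)
import Data.List.Membership.DecPropositional as DecMembership
open import Data.List.Relation.Binary.Permutation.Propositional
  using (_↭_; ↭-refl; ↭-trans; ↭-reflexive; prep; ↭⇒↭ₛ′)
open import Data.List.Relation.Binary.Permutation.Propositional.Properties
  using (shift; map⁺; All-resp-↭)
import Data.List.Relation.Binary.Permutation.Setoid.Properties as SetoidPermutation
open import Function using (_∘_)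
open import Relation.Nullary using (¬_; Dec; yes; no)
open import Relation.Nullary.Decidable using (from-yes; ¬?; _×-dec_; _⊎-dec_)
open import Relation.Binary.PropositionalEquality as ≡ using (_≡_; _≢_; refl; cong; subst)
open import Data.Empty using (⊥-elim)
open import Relation.Binary.Definitions using (DecidableEquality)
open import Relation.Binary.Bundles using (Poset)
open import Relation.Binary.Structures using (IsTotalOrder)

SubBag : ∀ {a} {A : Set a} → List A → List A → Set a
SubBag xs ys = ∃ λ zs → ys ↭ xs ++ zs

module _ {a} {A : Set a} (_≟_ : DecidableEquality A) where
  open DecMembership _≟_ using (_∈?_)

  extractFirst : (x : A) (ys : List A) → Maybe (∃ λ ys′ → ys ↭ x ∷ ys′)
  extractFirst x ys with x ∈? ys
  ... | no _ = nothing
  ... | yes x∈ys with ∈-∃++ x∈ys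
  ...   | us , vs , refl = just (us ++ vs , shift x us vs)

  searchSubBag : (xs ys : List A) → Maybe (SubBag xs ys)
  searchSubBag []       ys = just (ys , ↭-refl)
  searchSubBag (x ∷ xs) ys = do
    ys′ , ys↭x∷ys′ ← extractFirst x ys
    zs , ys′↭xs++zs ← searchSubBag xs ys′
    just (zs , ↭-trans ys↭x∷ys′ (prep x ys′↭xs++zs))

disjoint-incident : ∀ {c e f} → VertexDisjoint e f → Incident c e → ¬ Incident c f
disjoint-incident (u≢u′ , _ , _ , _) (inj₁ refl) (inj₁ refl) = u≢u′ refl
disjoint-incident (_ , u≢v′ , _ , _) (inj₁ refl) (inj₂ refl) = u≢v′ refl
disjoint-incident (_ , _ , v≢u′ , _) (inj₂ refl) (inj₁ refl) = v≢u′ refl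
disjoint-incident (_ , _ , _ , v≢v′) (inj₂ refl) (inj₂ refl) = v≢v′ refl

avoiding : Vertex → List Edge → List Edge
avoiding c = filter (¬? ∘ incident? c)

length-matching-≤-suc-avoiding : ∀ c M → AllPairs VertexDisjoint M →
                                 length M ℕ.≤ suc (length (avoiding c M))
length-matching-≤-suc-avoiding c []      _ = z≤n
length-matching-≤-suc-avoiding c (e ∷ M) (e#M ∷ disjoint) with incident? c e
... | yes c∈e
  rewrite filter-reject (¬? ∘ incident? c) {e} {M} (λ c∉e → c∉e c∈e)
        | filter-all (¬? ∘ incident? c) (All.map (λ e#f → disjoint-incident e#f c∈e) e#M)
  = ℕₚ.≤-refl
... | no c∉e
  rewrite filter-accept (¬? ∘ incident? c) {e} {M} c∉e
  = ℕ.s≤s (length-matching-≤-suc-avoiding c M disjoint)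

Covers : List Vertex → List Edge → Set
Covers C = All (λ e → Any (λ c → Incident c e) C)

matching-≤-cover : ∀ C M → Covers C M → AllPairs VertexDisjoint M → length M ℕ.≤ length C
matching-≤-cover []      []      _           _        = z≤n
matching-≤-cover []      (_ ∷ _) (() ∷ _)    _
matching-≤-cover (c ∷ C) M       covered     disjoint =
  ℕₚ.≤-trans (length-matching-≤-suc-avoiding c M disjoint)
             (ℕ.s≤s (matching-≤-cover C (avoiding c M) covered′ (AllPairs.filter⁺ _ disjoint)))
  where
  covered-by-rest : ∀ {e} → Any (λ c′ → Incident c′ e) (c ∷ C) → ¬ Incident c e →
                    Any (λ c′ → Incident c′ e) C
  covered-by-rest (here c∈e) c∉e = ⊥-elim (c∉e c∈e)
  covered-by-rest (there C∋e) _  = C∋e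
  covered′ : Covers C (avoiding c M)
  covered′ = All.zipWith (λ (C∋e , c∉e) → covered-by-rest C∋e c∉e)
                         (All.filter⁺ _ covered , All.all-filter _ M)

maximum-by-cover : ∀ {G M C} → IsMatching G M → Covers C G → length C ≡ length M →
                   IsMaximumMatching G M
maximum-by-cover {C = C} matching covered |C|≡|M| = matching , λ M′ (M′⊆G , disjoint) →
  subst (length M′ ℕ.≤_) |C|≡|M|
        (matching-≤-cover C M′ (All.map (All.lookup covered) M′⊆G) disjoint)

Below : ℕ → Edge → Set
Below n (u , v) = u < n × v < n

maxDegree-below : ∀ {k es} n → All (Below n) es →
                  (∀ (i : Fin n) → degree (toℕ i) es ℕ.≤ k) → MaxDegreeAtMost k es
maxDegree-below {k} {es} n below deg w with w <? n
... | yes w<n = subst (λ v → degree v es ℕ.≤ k) (toℕ-fromℕ< w<n) (deg (fromℕ< w<n))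
... | no  w≮n =
  subst (ℕ._≤ k) (cong length (≡.sym (filter-none (incident? w) (All.map not-incident below)))) z≤n
  where
  not-incident : ∀ {e} → Below n e → ¬ Incident w e
  not-incident (u<n , _) (inj₁ refl) = w≮n u<n
  not-incident (_ , v<n) (inj₂ refl) = w≮n v<n

below? : ∀ n → (e : Edge) → Dec (Below n e)
below? n (u , v) = (u <? n) ×-dec (v <? n)

simple? : ∀ es → Dec (SimpleGraph es)
simple? es =
  all? (λ e → ¬? (proj₁ e ℕ.≟ proj₂ e)) es ×-dec allPairs? (λ e f → ¬? (sameEdge? e f)) es
  where
  sameEdge? : ∀ e f → Dec (SameEdge e f)
  sameEdge? (u , v) (u′ , v′) =
    ((u ℕ.≟ u′) ×-dec (v ℕ.≟ v′)) ⊎-dec ((u ℕ.≟ v′) ×-dec (v ℕ.≟ u′))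

properlyColoured? : (col : Vertex → Bool) → ∀ es →
                    Dec (All (λ e → col (proj₁ e) ≢ col (proj₂ e)) es)
properlyColoured? col = all? (λ e → ¬? (col (proj₁ e) Bool.≟ col (proj₂ e)))

edge≟ : DecidableEquality Edge
edge≟ = ×-≡-dec ℕ._≟_ ℕ._≟_

isMatching? : ∀ G M → Dec (IsMatching G M)
isMatching? G M = all? (λ e → DecMembership._∈?_ edge≟ e G) M ×-dec allPairs? disjoint? M
  where
  disjoint? : ∀ e f → Dec (VertexDisjoint e f)
  disjoint? (u , v) (u′ , v′) =
    ¬? (u ℕ.≟ u′) ×-dec ¬? (u ℕ.≟ v′) ×-dec ¬? (v ℕ.≟ u′) ×-dec ¬? (v ℕ.≟ v′)

covers? : ∀ C es → Dec (Covers C es)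
covers? C = all? (λ e → any? (λ c → incident? c e) C)

-- An arrival is the arriving edge together with the edges that arrived before
-- it; this determines the value a deterministic algorithm assigns to it.
Arrival : Set
Arrival = List Edge × Edge

arrivalsFrom : List Edge → List Edge → List Arrival
arrivalsFrom history []       = []
arrivalsFrom history (e ∷ es) = (history , e) ∷ arrivalsFrom (history ++ [ e ]) es

arrivals : List Edge → List Arrival
arrivals = arrivalsFrom []

incidentArrivals : Vertex → List Edge → List Arrival
incidentArrivals w G = filter (incident? w ∘ proj₂) (arrivals G)

arrival≟ : DecidableEquality Arrival
arrival≟ = ×-≡-dec (List-≡-dec edge≟) edge≟

module OrderedFieldProperties {c ℓ₁ ℓ₂} (F : OrderedField c ℓ₁ ℓ₂) where
  open OrderedField F
  open IsTotalOrder isTotalOrder public using (antisym)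
    renaming (total to ≤-total; refl to ≤-refl; reflexive to ≤-reflexive; trans to ≤-trans)
  open import Algebra.Properties.Ring ring using (-‿distribʳ-*; -1*x≈-x; -‿involutive)
  open import Algebra.Properties.Semiring.Mult semiring
    using (×-homo-+; ×1-homo-*) renaming (_×_ to _·_)

  poset : Poset c ℓ₁ ℓ₂
  poset = record { isPartialOrder = IsTotalOrder.isPartialOrder isTotalOrder }

  open import Relation.Binary.Reasoning.PartialOrder poset

  +-mono-≤₂ : ∀ {x y u v} → x ≤ y → u ≤ v → (x + u) ≤ (y + v)
  +-mono-≤₂ {x} {y} {u} {v} x≤y u≤v = begin
    x + u ≤⟨ +-mono-≤ u x≤y ⟩
    y + u ≈⟨ +-comm y u ⟩
    u + y ≤⟨ +-mono-≤ y u≤v ⟩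
    v + y ≈⟨ +-comm v y ⟩
    y + v ∎

  x≤x+y : ∀ {x y} → 0# ≤ y → x ≤ (x + y)
  x≤x+y {x} {y} 0≤y = begin
    x      ≈⟨ +-identityʳ x ⟨
    x + 0# ≤⟨ +-mono-≤₂ ≤-refl 0≤y ⟩
    x + y  ∎

  ≤⇒0≤y-x : ∀ {x y} → x ≤ y → 0# ≤ (y + - x)
  ≤⇒0≤y-x {x} {y} x≤y = begin
    0#      ≈⟨ -‿inverseʳ x ⟨
    x + - x ≤⟨ +-mono-≤ (- x) x≤y ⟩
    y + - x ∎

  0≤y-x⇒≤ : ∀ {x y} → 0# ≤ (y + - x) → x ≤ y
  0≤y-x⇒≤ {x} {y} 0≤y-x = begin
    x             ≈⟨ +-identityˡ x ⟨
    0# + x        ≤⟨ +-mono-≤ x 0≤y-x ⟩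
    y + - x + x   ≈⟨ +-assoc y (- x) x ⟩
    y + (- x + x) ≈⟨ +-congˡ (-‿inverseˡ x) ⟩
    y + 0#        ≈⟨ +-identityʳ y ⟩
    y             ∎

  -- If 1 ≤ 0 then 0 ≤ -1, and the square (-1) * (-1) = 1 would be non-negative.
  0≤1 : 0# ≤ 1#
  0≤1 with ≤-total 0# 1#
  ... | inj₁ 0≤1 = 0≤1
  ... | inj₂ 1≤0 = begin
    0#                     ≤⟨ *-nonneg (≤⇒0≤y-x 1≤0) (≤⇒0≤y-x 1≤0) ⟩
    (0# + - 1#) * (0# + - 1#) ≈⟨ *-cong (+-identityˡ (- 1#)) (+-identityˡ (- 1#)) ⟩
    - 1# * - 1#            ≈⟨ -1*x≈-x (- 1#) ⟩
    - - 1#                 ≈⟨ -‿involutive 1# ⟩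
    1#                     ∎

  *-monoˡ-≤ : ∀ {a x y} → 0# ≤ a → x ≤ y → (a * x) ≤ (a * y)
  *-monoˡ-≤ {a} {x} {y} 0≤a x≤y = 0≤y-x⇒≤ (begin
    0#                  ≤⟨ *-nonneg 0≤a (≤⇒0≤y-x x≤y) ⟩
    a * (y + - x)       ≈⟨ distribˡ a y (- x) ⟩
    a * y + a * - x     ≈⟨ +-congˡ (-‿distribʳ-* a x) ⟨
    a * y + - (a * x)   ∎)

  *-cancelʳ-≤ : ∀ {a x y} → 0# ≤ a → ¬ (a ≈ 0#) → (x * a) ≤ (y * a) → x ≤ y
  *-cancelʳ-≤ {a} {x} {y} 0≤a a≉0 xa≤ya with ≤-total x y
  ... | inj₁ x≤y = x≤y
  ... | inj₂ y≤x = ≤-reflexive (begin-equality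
    x              ≈⟨ undo x ⟨
    x * a * a⁻¹    ≈⟨ *-congʳ xa≈ya ⟩
    y * a * a⁻¹    ≈⟨ undo y ⟩
    y              ∎)
    where
    a⁻¹ = proj₁ (inverse a a≉0)
    undo : ∀ z → z * a * a⁻¹ ≈ z
    undo z = begin-equality
      z * a * a⁻¹   ≈⟨ *-assoc z a a⁻¹ ⟩
      z * (a * a⁻¹) ≈⟨ *-congˡ (proj₂ (inverse a a≉0)) ⟩
      z * 1#        ≈⟨ *-identityʳ z ⟩
      z             ∎
    xa≈ya : x * a ≈ y * a
    xa≈ya = antisym xa≤ya (begin
      y * a ≈⟨ *-comm y a ⟩
      a * y ≤⟨ *-monoˡ-≤ 0≤a y≤x ⟩
      a * x ≈⟨ *-comm a x ⟩
      x * a ∎)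

  fromℕ≡·1 : ∀ n → fromℕ n ≡ n · 1#
  fromℕ≡·1 zero    = ≡.refl
  fromℕ≡·1 (suc n) = cong (1# +_) (fromℕ≡·1 n)

  fromℕ-+ : ∀ m n → fromℕ (m ℕ.+ n) ≈ fromℕ m + fromℕ n
  fromℕ-+ m n rewrite fromℕ≡·1 (m ℕ.+ n) | fromℕ≡·1 m | fromℕ≡·1 n = ×-homo-+ 1# m n

  fromℕ-* : ∀ m n → fromℕ (m ℕ.* n) ≈ fromℕ m * fromℕ n
  fromℕ-* m n rewrite fromℕ≡·1 (m ℕ.* n) | fromℕ≡·1 m | fromℕ≡·1 n = ×1-homo-* m n

  0≤fromℕ : ∀ n → 0# ≤ fromℕ n
  0≤fromℕ zero    = ≤-refl
  0≤fromℕ (suc n) = ≤-trans 0≤1 (x≤x+y (0≤fromℕ n))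

  fromℕ-suc≉0 : ∀ n → ¬ (fromℕ (suc n) ≈ 0#)
  fromℕ-suc≉0 n 1+n≈0 =
    nontrivial (antisym (≤-trans (x≤x+y (0≤fromℕ n)) (≤-reflexive 1+n≈0)) 0≤1)

  fromℕ-≤-+ : ∀ m k → fromℕ m ≤ fromℕ (m ℕ.+ k)
  fromℕ-≤-+ m k = ≤-trans (x≤x+y (0≤fromℕ k)) (≤-reflexive (sym (fromℕ-+ m k)))

  -- x ≤ p / (q + 1) and p / (q + 1) ≤ M / N give x ≤ M / N; the second inequality
  -- is passed as an equation with explicit slack k, avoiding unary proofs of ≤ on ℕ.
  ratio-bound : ∀ {x} q p N M k → (x * fromℕ (suc q)) ≤ fromℕ p →
                N ℕ.* p ℕ.+ k ≡ M ℕ.* suc q → (fromℕ N * x) ≤ fromℕ M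
  ratio-bound {x} q p N M k xQ≤p Np+k≡MQ =
    *-cancelʳ-≤ (0≤fromℕ (suc q)) (fromℕ-suc≉0 q) (begin
      fromℕ N * x * fromℕ (suc q)   ≈⟨ *-assoc (fromℕ N) x (fromℕ (suc q)) ⟩
      fromℕ N * (x * fromℕ (suc q)) ≤⟨ *-monoˡ-≤ (0≤fromℕ N) xQ≤p ⟩
      fromℕ N * fromℕ p             ≈⟨ fromℕ-* N p ⟨
      fromℕ (N ℕ.* p)               ≤⟨ fromℕ-≤-+ (N ℕ.* p) k ⟩
      fromℕ (N ℕ.* p ℕ.+ k)         ≡⟨ cong fromℕ Np+k≡MQ ⟩
      fromℕ (M ℕ.* suc q)           ≈⟨ fromℕ-* M (suc q) ⟩
      fromℕ M * fromℕ (suc q)       ∎)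

  sum : List Carrier → Carrier
  sum = foldr _+_ 0#

  sum-++ : ∀ xs ys → sum (xs ++ ys) ≈ sum xs + sum ys
  sum-++ []       ys = sym (+-identityˡ (sum ys))
  sum-++ (x ∷ xs) ys = trans (+-congˡ (sum-++ xs ys)) (sym (+-assoc x (sum xs) (sum ys)))

  sum-nonneg : ∀ {xs} → All (0# ≤_) xs → 0# ≤ sum xs
  sum-nonneg []           = ≤-refl
  sum-nonneg (0≤x ∷ 0≤xs) = ≤-trans 0≤x (x≤x+y (sum-nonneg 0≤xs))

  sum-↭ : ∀ {xs ys} → xs ↭ ys → sum xs ≈ sum ys
  sum-↭ = SetoidPermutation.foldr-commMonoid setoid +-isCommutativeMonoid ∘ ↭⇒↭ₛ′ isEquivalence

  sum-mono-subBag : ∀ {xs ys} → All (0# ≤_) ys → SubBag xs ys → sum xs ≤ sum ys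
  sum-mono-subBag {xs} {ys} 0≤ys (zs , ys↭xs++zs) = begin
    sum xs            ≤⟨ x≤x+y (sum-nonneg 0≤zs) ⟩
    sum xs + sum zs   ≈⟨ sum-++ xs zs ⟨
    sum (xs ++ zs)    ≈⟨ sum-↭ ys↭xs++zs ⟨
    sum ys            ∎
    where
    0≤zs : All (0# ≤_) zs
    0≤zs = proj₂ (All.++⁻ xs (All-resp-↭ ys↭xs++zs 0≤ys))

guaranteedArrivals : {S : Set} → (S → List Edge) → List (S × List Edge) → List Arrival
guaranteedArrivals graph = concatMap (arrivals ∘ graph ∘ proj₁)

loadedArrivals : {S : Set} → (S → List Edge) → List (S × Vertex) → List Arrival
loadedArrivals graph = concatMap (λ (s , w) → incidentArrivals w (graph s))

matchedTotal : {S : Set} → List (S × List Edge) → ℕ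
matchedTotal = sumℕ ∘ map (length ∘ proj₂)

module ArrivalValues {c ℓ₁ ℓ₂} (F : OrderedField c ℓ₁ ℓ₂) (A : OnlineAlgorithm F) where
  open OrderedField F
  open OrderedFieldProperties F using (sum; sum-++)

  value : Arrival → Carrier
  value (history , e) = A history e

  Σvalue : List Arrival → Carrier
  Σvalue = sum ∘ map value

  Σvalue-++ : ∀ xs ys → Σvalue (xs ++ ys) ≈ Σvalue xs + Σvalue ys
  Σvalue-++ xs ys =
    trans (reflexive (cong sum (map-++ value xs ys))) (sum-++ (map value xs) (map value ys))

  total-runFrom : ∀ history es →
                  total F (runFrom F A history es) ≡ Σvalue (arrivalsFrom history es)
  total-runFrom history []       = ≡.refl
  total-runFrom history (e ∷ es) = cong (A history e +_) (total-runFrom (history ++ [ e ]) es)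

  load-runFrom : ∀ w history es →
                 load F w (runFrom F A history es) ≡
                 Σvalue (filter (incident? w ∘ proj₂) (arrivalsFrom history es))
  load-runFrom w history []       = ≡.refl
  load-runFrom w history (e ∷ es) with incident? w e
  ... | yes w∈e
    rewrite filter-accept (incident? w ∘ proj₂) {history , e} {arrivalsFrom (history ++ [ e ]) es} w∈e
    = cong (A history e +_) (load-runFrom w (history ++ [ e ]) es)
  ... | no  w∉e
    rewrite filter-reject (incident? w ∘ proj₂) {history , e} {arrivalsFrom (history ++ [ e ]) es} w∉e
    = load-runFrom w (history ++ [ e ]) es

  nonneg-runFrom : ∀ history es → All (λ p → 0# ≤ proj₂ p) (runFrom F A history es) →
                   All (λ a → 0# ≤ value a) (arrivalsFrom history es)
  nonneg-runFrom history []       []           = []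
  nonneg-runFrom history (e ∷ es) (0≤y ∷ 0≤ys) = 0≤y ∷ nonneg-runFrom (history ++ [ e ]) es 0≤ys

module Charging {c ℓ₁ ℓ₂} (F : OrderedField c ℓ₁ ℓ₂) (A : OnlineAlgorithm F)
                (γ : OrderedField.Carrier F) {S : Set}
                (graph : S → List Edge) (good : ∀ s → GoodAt F A γ (graph s)) where
  open OrderedField F
  open OrderedFieldProperties F
  open ArrivalValues F A
  open import Relation.Binary.Reasoning.PartialOrder poset

  guaranteed : ∀ gs → All (λ (s , M) → IsMaximumMatching (graph s) M) gs →
               (γ * fromℕ (matchedTotal gs)) ≤ Σvalue (guaranteedArrivals graph gs)
  guaranteed []             []           = ≤-reflexive (zeroʳ γ)
  guaranteed ((s , M) ∷ gs) (max ∷ maxs) = begin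
    γ * fromℕ (length M ℕ.+ matchedTotal gs)
      ≈⟨ *-congˡ (fromℕ-+ (length M) (matchedTotal gs)) ⟩
    γ * (fromℕ (length M) + fromℕ (matchedTotal gs))
      ≈⟨ distribˡ γ (fromℕ (length M)) (fromℕ (matchedTotal gs)) ⟩
    γ * fromℕ (length M) + γ * fromℕ (matchedTotal gs)
      ≤⟨ +-mono-≤₂ guarantee (guaranteed gs maxs) ⟩
    Σvalue (arrivals (graph s)) + Σvalue (guaranteedArrivals graph gs)
      ≈⟨ Σvalue-++ (arrivals (graph s)) (guaranteedArrivals graph gs) ⟨
    Σvalue (guaranteedArrivals graph ((s , M) ∷ gs)) ∎
    where
    guarantee : (γ * fromℕ (length M)) ≤ Σvalue (arrivals (graph s))
    guarantee = subst ((γ * fromℕ (length M)) ≤_) (total-runFrom [] (graph s))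
                      (proj₂ (proj₂ (good s)) M max)

  loaded : ∀ ls → Σvalue (loadedArrivals graph ls) ≤ fromℕ (length ls)
  loaded []             = ≤-refl
  loaded ((s , w) ∷ ls) = begin
    Σvalue (loadedArrivals graph ((s , w) ∷ ls))
      ≈⟨ Σvalue-++ (incidentArrivals w (graph s)) (loadedArrivals graph ls) ⟩
    Σvalue (incidentArrivals w (graph s)) + Σvalue (loadedArrivals graph ls)
      ≤⟨ +-mono-≤₂ capacity (loaded ls) ⟩
    1# + fromℕ (length ls) ∎
    where
    capacity : Σvalue (incidentArrivals w (graph s)) ≤ 1#
    capacity = subst (_≤ 1#) (load-runFrom w [] (graph s)) (proj₁ (proj₂ (good s)) w)

  loaded-nonneg : ∀ ls → All (λ a → 0# ≤ value a) (loadedArrivals graph ls)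
  loaded-nonneg []             = []
  loaded-nonneg ((s , w) ∷ ls) =
    All.++⁺ (All.filter⁺ _ (nonneg-runFrom [] (graph s) (proj₁ (good s)))) (loaded-nonneg ls)

  charging : ∀ gs ls → All (λ (s , M) → IsMaximumMatching (graph s) M) gs →
             SubBag (guaranteedArrivals graph gs) (loadedArrivals graph ls) →
             (γ * fromℕ (matchedTotal gs)) ≤ fromℕ (length ls)
  charging gs ls maxs (zs , shared) = begin
    γ * fromℕ (matchedTotal gs)             ≤⟨ guaranteed gs maxs ⟩
    Σvalue (guaranteedArrivals graph gs)    ≤⟨ sum-mono-subBag (All.map⁺ (loaded-nonneg ls))
                                                                (map value zs , shared′) ⟩
    Σvalue (loadedArrivals graph ls)        ≤⟨ loaded ls ⟩
    fromℕ (length ls)                        ∎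
    where
    shared′ : map value (loadedArrivals graph ls) ↭
              map value (guaranteedArrivals graph gs) ++ map value zs
    shared′ = ↭-trans (map⁺ value shared)
                      (↭-reflexive (map-++ value (guaranteedArrivals graph gs) zs))

square : List Edge
square = (0 , 1) ∷ (0 , 3) ∷ (1 , 2) ∷ (2 , 3) ∷ []

sequence : Fin 3 → List Edge
sequence zero             = square ++ (0 , 5) ∷ (1 , 4) ∷ (0 , 7) ∷ []
sequence (suc zero)       = square ++ (3 , 4) ∷ (0 , 5) ∷ (2 , 5) ∷ (0 , 7) ∷ (1 , 6) ∷ []
sequence (suc (suc zero)) = square ++ (3 , 4) ∷ (0 , 5) ∷ (2 , 5) ∷ (4 , 5) ∷ (0 , 7) ∷ (1 , 6)
                                   ∷ (3 , 8) ∷ (2 , 9) ∷ (4 , 11) ∷ (5 , 10) ∷ []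

isEven : Vertex → Bool
isEven n = n % 2 ℕ.≡ᵇ 0

admissible : ∀ i → BipartiteMaxDeg4 (sequence i)
admissible i = simple i , (isEven , coloured i) , maxDegree-below 12 (bounded i) (degrees i)
  where
  simple : ∀ i → SimpleGraph (sequence i)
  simple = from-yes (allFin? (simple? ∘ sequence))
  coloured : ∀ i → All (λ e → isEven (proj₁ e) ≢ isEven (proj₂ e)) (sequence i)
  coloured = from-yes (allFin? (properlyColoured? isEven ∘ sequence))
  bounded : ∀ i → All (Below 12) (sequence i)
  bounded = from-yes (allFin? (all? (below? 12) ∘ sequence))
  degrees : ∀ i (v : Fin 12) → degree (toℕ v) (sequence i) ℕ.≤ 4
  degrees = from-yes (allFin? λ i → allFin? λ (v : Fin 12) → degree (toℕ v) (sequence i) ℕ.≤? 4)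

Snapshot : Set
Snapshot = Fin 3 × ℕ

snapshot : Snapshot → List Edge
snapshot (i , t) = take t (sequence i)

-- Repeated entries give their constraint weight 2 in the combination.
guarantees : List (Snapshot × List Edge)
guarantees =
    ((# 0 , 1)  , (0 , 1) ∷ [])
  ∷ ((# 0 , 1)  , (0 , 1) ∷ [])
  ∷ ((# 0 , 3)  , (0 , 3) ∷ (1 , 2) ∷ [])
  ∷ ((# 0 , 3)  , (0 , 3) ∷ (1 , 2) ∷ [])
  ∷ ((# 0 , 7)  , (2 , 3) ∷ (0 , 5) ∷ (1 , 4) ∷ [])
  ∷ ((# 1 , 9)  , (3 , 4) ∷ (2 , 5) ∷ (0 , 7) ∷ (1 , 6) ∷ [])
  ∷ ((# 2 , 12) , (4 , 5) ∷ (0 , 7) ∷ (1 , 6) ∷ (3 , 8) ∷ (2 , 9) ∷ [])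
  ∷ ((# 2 , 14) , (0 , 7) ∷ (1 , 6) ∷ (3 , 8) ∷ (2 , 9) ∷ (4 , 11) ∷ (5 , 10) ∷ [])
  ∷ []

loads : List (Snapshot × Vertex)
loads = ((# 0 , 7) , 0) ∷ ((# 0 , 7) , 1) ∷ ((# 1 , 9) , 0) ∷ ((# 1 , 9) , 1)
      ∷ map ((# 2 , 14) ,_) (0 ∷ 0 ∷ 1 ∷ 1 ∷ 2 ∷ 2 ∷ 3 ∷ 3 ∷ 4 ∷ 5 ∷ [])

-- In each guaranteed snapshot the first |M| vertices cover all edges, so M is maximum.
maximum : All (λ (s , M) → IsMaximumMatching (snapshot s) M) guarantees
maximum = All.map (λ {(_ , M)} (matching , covered) →
                     maximum-by-cover matching covered (length-upTo (length M)))
                  (from-yes (all? certified? guarantees))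
  where
  certified? : ∀ ((s , M) : Snapshot × List Edge) →
               Dec (IsMatching (snapshot s) M × Covers (upTo (length M)) (snapshot s))
  certified? (s , M) = isMatching? (snapshot s) M ×-dec covers? (upTo (length M)) (snapshot s)

shared : SubBag (guaranteedArrivals snapshot guarantees) (loadedArrivals snapshot loads)
shared = from-just (searchSubBag arrival≟ (guaranteedArrivals snapshot guarantees)
                                         (loadedArrivals snapshot loads))

theorem3 : ∀ {c ℓ₁ ℓ₂} (F : OrderedField c ℓ₁ ℓ₂) (A : OnlineAlgorithm F) (γ : OrderedField.Carrier F) →
    AchievesGuarantee F BipartiteMaxDeg4 A γ →
    OrderedField._≤_ F (OrderedField._*_ F (OrderedField.fromℕ F 100000) γ) (OrderedField.fromℕ F 58884)
theorem3 F A γ H = ratio-bound 23 14 100000 58884 13216 (charging guarantees loads maximum shared) refl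
  where
  open OrderedFieldProperties F using (ratio-bound)
  open Charging F A γ snapshot (λ (i , t) → H (sequence i) (admissible i) t) using (charging)
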